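{- For every positive integer $n$, $\mathrm{l}_o(n)=\mathrm{s}(n)$.
   Context: $\mathrm{l}_o(n)$ is the number of partitions of $n$ in which the number of appearances of the largest part is odd. $\mathrm{s}(n)$ is the number of partitions of $n$ whose smallest part is odd. -}

module Defs where

open import Data.Nat using (ℕ; zero; suc; _+_; _≥_; _<_)
open import Data.Nat.Properties using (_≟_)
open import Data.List using (List; []; _∷_; length; filter; head; last)
open import Data.Nat.ListAction using (sum)
open import Data.List.Relation.Unary.All using (All)
open import Data.List.Relation.Unary.Linked using (Linked)
open import Data.Maybe using (Maybe; just; nothing)
open import Data.Product using (Σ; _×_; ∃)
open import Data.Empty using (⊥)
open import Data.Unit using (⊤)
open import Relation.Binary.PropositionalEquality using (_≡_)
open import Data.Nat using (_%_)

record IsPartition (n : ℕ) (λs : List ℕ) : Set where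
  field
    positive   : All (λ p → 0 < p) λs
    decreasing : Linked _≥_ λs
    sums       : sum λs ≡ n

Partition : ℕ → Set
Partition n = Σ (List ℕ) (IsPartition n)

Odd : ℕ → Set
Odd k = k % 2 ≡ 1

count : ℕ → List ℕ → ℕ
count a xs = length (filter (λ x → x ≟ a) xs)

-- the largest part (the head, since parts are decreasing) appears an odd number of times
LargestOddMult : List ℕ → Set
LargestOddMult [] = ⊥
LargestOddMult (x ∷ xs) = Odd (count x (x ∷ xs))

-- the smallest part (the last, since parts are decreasing) is odd
SmallestOdd : List ℕ → Set
SmallestOdd xs with last xs
... | nothing = ⊥
... | just y  = Odd y

Lo : ℕ → Set
Lo n = Σ (List ℕ) (λ xs → IsPartition n xs × LargestOddMult xs)

S : ℕ → Set
S n = Σ (List ℕ) (λ xs → IsPartition n xs × SmallestOdd xs)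

{-# OPTIONS --safe #-}
-- Conjugation is a size-preserving involution on partitions, and the multiplicity of the
-- largest part of a partition is the smallest part of its conjugate. Hence conjugation maps
-- the partitions counted by l_o(n) bijectively onto those counted by s(n).
module Submission where

open import Defs
open import Data.Bool using (Bool; true; false; not)
open import Data.Bool.Properties using (not-involutive)
open import Data.List using (List; []; _∷_; _++_; [_]; _∷ʳ_; map; reverse; replicate; last; length)
open import Data.List.Properties
  using (unfold-reverse; reverse-++; reverse-map; reverse-involutive; map-++; map-∘; map-cong; map-id;
         ++-assoc; ++-identityʳ; filter-accept; filter-none)
open import Data.List.Relation.Unary.All as All using (All; []; _∷_)
open import Data.List.Relation.Unary.All.Properties using (last⁺)
open import Data.List.Relation.Unary.Linked as Linked using (Linked; []; [-]; _∷_)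
open import Data.List.Relation.Unary.Linked.Properties using (Linked⇒All)
open import Data.Maybe using (just; nothing)
open import Data.Maybe.Relation.Unary.All as Maybe using (just)
open import Data.Nat using (ℕ; zero; suc; _+_; _∸_; _≤_; _<_; _≥_; z≤n; s≤s)
open import Data.Nat.ListAction using (sum)
open import Data.Nat.Properties
  using (_≟_; ≤-refl; ≤-trans; ≤-<-trans; ≤-irrelevant; <-irrelevant; ≡-irrelevant; <⇒≢; m≤n+m; m∸n+n≡m; m+n∸n≡m;
         n∸n≡0; m<n⇒0<n∸m; m≤n⇒m<n∨m≡n; +-comm; +-identityʳ)
open import Data.Nat.Tactic.RingSolver using (solve-∀)
open import Data.Product using (Σ; ∃-syntax; ∃₂; _×_; _,_)
open import Data.Sum using (inj₁; inj₂)
open import Function.Base using (_∘_; id)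
open import Function.Bundles using (_↔_; _⇔_; mk↔ₛ′; mk⇔; Equivalence)
open import Function.Construct.Identity using (⇔-id)
open import Function.Construct.Symmetry using (⇔-sym)
open import Function.Related.Propositional using (module EquationalReasoning)
open import Relation.Binary.PropositionalEquality using (_≡_; refl; sym; trans; cong; cong₂; subst; module ≡-Reasoning)
open import Relation.Nullary.Irrelevant using (Irrelevant)

open IsPartition

-- Partitions are handled through the boundary words of their Ferrers diagrams: each part
-- contributes a `false` followed by as many `true`s as it exceeds the next part. A part is then
-- the number of `true`s after its `false`, the size is the number of pairs `false` before
-- `true`, and reversing and complementing the word transposes the diagram. The multiplicity of
-- the largest part is the number of leading `false`s, the smallest part the number of trailing
-- `true`s.
Word : Set
Word = List Bool

trues : Word → ℕ
trues []          = 0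
trues (true ∷ w)  = suc (trues w)
trues (false ∷ w) = trues w

falses : Word → ℕ
falses []          = 0
falses (true ∷ w)  = falses w
falses (false ∷ w) = suc (falses w)

leadingFalses : Word → ℕ
leadingFalses (false ∷ w) = suc (leadingFalses w)
leadingFalses _           = 0

leadingTrues : Word → ℕ
leadingTrues (true ∷ w) = suc (leadingTrues w)
leadingTrues _          = 0

dropLeadingTrues : Word → Word
dropLeadingTrues (true ∷ w) = dropLeadingTrues w
dropLeadingTrues w          = w

parts : Word → List ℕ
parts []          = []
parts (true ∷ w)  = parts w
parts (false ∷ w) = trues w ∷ parts w

largestPart : List ℕ → ℕ
largestPart []      = 0
largestPart (x ∷ _) = x

boundary : List ℕ → Word
boundary []      = []
boundary (x ∷ r) = false ∷ replicate (x ∸ largestPart r) true ++ boundary r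

dual : Word → Word
dual w = reverse (map not w)

conjugate : List ℕ → List ℕ
conjugate λs = parts (dual (boundary λs))

dual-∷ : ∀ b w → dual (b ∷ w) ≡ dual w ∷ʳ not b
dual-∷ b w = unfold-reverse (not b) (map not w)

dual-++ : ∀ u v → dual (u ++ v) ≡ dual v ++ dual u
dual-++ u v = trans (cong reverse (map-++ not u v)) (reverse-++ (map not u) (map not v))

dual-involutive : ∀ w → dual (dual w) ≡ w
dual-involutive w = begin
  reverse (map not (reverse (map not w))) ≡⟨ cong reverse (reverse-map not (map not w)) ⟩
  reverse (reverse (map not (map not w))) ≡⟨ reverse-involutive _ ⟩
  map not (map not w)                     ≡⟨ map-∘ w ⟨
  map (not ∘ not) w                       ≡⟨ map-cong not-involutive w ⟩
  map id w                                ≡⟨ map-id w ⟩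
  w                                       ∎
  where open ≡-Reasoning

replicate-∷ʳ : ∀ {A : Set} k (a : A) → replicate k a ∷ʳ a ≡ a ∷ replicate k a
replicate-∷ʳ zero    a = refl
replicate-∷ʳ (suc k) a = cong (a ∷_) (replicate-∷ʳ k a)

dual-replicate : ∀ k b → dual (replicate k b) ≡ replicate k (not b)
dual-replicate zero    b = refl
dual-replicate (suc k) b = begin
  dual (b ∷ replicate k b)             ≡⟨ dual-∷ b (replicate k b) ⟩
  dual (replicate k b) ∷ʳ not b        ≡⟨ cong (_∷ʳ not b) (dual-replicate k b) ⟩
  replicate k (not b) ∷ʳ not b         ≡⟨ replicate-∷ʳ k (not b) ⟩
  not b ∷ replicate k (not b)          ∎
  where open ≡-Reasoning

dual-++-false∷replicate : ∀ u k → dual (u ++ false ∷ replicate k true) ≡ (replicate k false ∷ʳ true) ++ dual u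
dual-++-false∷replicate u k = begin
  dual (u ++ false ∷ replicate k true)          ≡⟨ dual-++ u (false ∷ replicate k true) ⟩
  dual (false ∷ replicate k true) ++ dual u     ≡⟨ cong (_++ dual u) (dual-∷ false (replicate k true)) ⟩
  (dual (replicate k true) ∷ʳ true) ++ dual u   ≡⟨ cong (λ v → v ∷ʳ true ++ dual u) (dual-replicate k true) ⟩
  (replicate k false ∷ʳ true) ++ dual u         ∎
  where open ≡-Reasoning

leadingFalses-replicate : ∀ k v → leadingFalses ((replicate k false ∷ʳ true) ++ v) ≡ k
leadingFalses-replicate zero    v = refl
leadingFalses-replicate (suc k) v = cong suc (leadingFalses-replicate k v)

trues-∷ʳ : ∀ w b → trues (w ∷ʳ b) ≡ trues w + trues [ b ]
trues-∷ʳ []          b = refl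
trues-∷ʳ (true ∷ w)  b = cong suc (trues-∷ʳ w b)
trues-∷ʳ (false ∷ w) b = trues-∷ʳ w b

falses-∷ʳ : ∀ w b → falses (w ∷ʳ b) ≡ falses w + falses [ b ]
falses-∷ʳ []          b = refl
falses-∷ʳ (true ∷ w)  b = falses-∷ʳ w b
falses-∷ʳ (false ∷ w) b = cong suc (falses-∷ʳ w b)

falses-dual : ∀ w → falses (dual w) ≡ trues w
falses-dual []          = refl
falses-dual (true ∷ w)  = begin
  falses (dual (true ∷ w)) ≡⟨ cong falses (dual-∷ true w) ⟩
  falses (dual w ∷ʳ false) ≡⟨ falses-∷ʳ (dual w) false ⟩
  falses (dual w) + 1      ≡⟨ cong (_+ 1) (falses-dual w) ⟩
  trues w + 1              ≡⟨ +-comm (trues w) 1 ⟩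
  suc (trues w)            ∎
  where open ≡-Reasoning
falses-dual (false ∷ w) = begin
  falses (dual (false ∷ w)) ≡⟨ cong falses (dual-∷ false w) ⟩
  falses (dual w ∷ʳ true)   ≡⟨ falses-∷ʳ (dual w) true ⟩
  falses (dual w) + 0       ≡⟨ +-identityʳ _ ⟩
  falses (dual w)           ≡⟨ falses-dual w ⟩
  trues w                   ∎
  where open ≡-Reasoning

sum-parts-∷ʳ-false : ∀ w → sum (parts (w ∷ʳ false)) ≡ sum (parts w)
sum-parts-∷ʳ-false []          = refl
sum-parts-∷ʳ-false (true ∷ w)  = sum-parts-∷ʳ-false w
sum-parts-∷ʳ-false (false ∷ w) =
  cong₂ _+_ (trans (trues-∷ʳ w false) (+-identityʳ (trues w))) (sum-parts-∷ʳ-false w)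

sum-parts-∷ʳ-true : ∀ w → sum (parts (w ∷ʳ true)) ≡ sum (parts w) + falses w
sum-parts-∷ʳ-true []          = refl
sum-parts-∷ʳ-true (true ∷ w)  = sum-parts-∷ʳ-true w
sum-parts-∷ʳ-true (false ∷ w) = begin
  trues (w ∷ʳ true) + sum (parts (w ∷ʳ true))  ≡⟨ cong₂ _+_ (trues-∷ʳ w true) (sum-parts-∷ʳ-true w) ⟩
  (trues w + 1) + (sum (parts w) + falses w)   ≡⟨ rearrange (trues w) (sum (parts w)) (falses w) ⟩
  (trues w + sum (parts w)) + suc (falses w)   ∎
  where
  open ≡-Reasoning
  rearrange : ∀ a b c → (a + 1) + (b + c) ≡ (a + b) + suc c
  rearrange = solve-∀

sum-parts-dual : ∀ w → sum (parts (dual w)) ≡ sum (parts w)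
sum-parts-dual []          = refl
sum-parts-dual (true ∷ w)  = begin
  sum (parts (dual (true ∷ w)))  ≡⟨ cong (sum ∘ parts) (dual-∷ true w) ⟩
  sum (parts (dual w ∷ʳ false))  ≡⟨ sum-parts-∷ʳ-false (dual w) ⟩
  sum (parts (dual w))           ≡⟨ sum-parts-dual w ⟩
  sum (parts w)                  ∎
  where open ≡-Reasoning
sum-parts-dual (false ∷ w) = begin
  sum (parts (dual (false ∷ w)))          ≡⟨ cong (sum ∘ parts) (dual-∷ false w) ⟩
  sum (parts (dual w ∷ʳ true))            ≡⟨ sum-parts-∷ʳ-true (dual w) ⟩
  sum (parts (dual w)) + falses (dual w)  ≡⟨ cong₂ _+_ (sum-parts-dual w) (falses-dual w) ⟩
  sum (parts w) + trues w                 ≡⟨ +-comm (sum (parts w)) (trues w) ⟩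
  trues w + sum (parts w)                 ∎
  where open ≡-Reasoning

trues-replicate-++ : ∀ k w → trues (replicate k true ++ w) ≡ k + trues w
trues-replicate-++ zero    w = refl
trues-replicate-++ (suc k) w = cong suc (trues-replicate-++ k w)

parts-replicate-++ : ∀ k w → parts (replicate k true ++ w) ≡ parts w
parts-replicate-++ zero    w = refl
parts-replicate-++ (suc k) w = parts-replicate-++ k w

largestPart-≤ : ∀ {x r} → Linked _≥_ (x ∷ r) → largestPart r ≤ x
largestPart-≤ [-]       = z≤n
largestPart-≤ (x≥y ∷ _) = x≥y

trues-boundary : ∀ {λs} → Linked _≥_ λs → trues (boundary λs) ≡ largestPart λs
trues-boundary {[]}    _ = refl
trues-boundary {x ∷ r} l = begin
  trues (replicate (x ∸ largestPart r) true ++ boundary r) ≡⟨ trues-replicate-++ (x ∸ largestPart r) (boundary r) ⟩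
  x ∸ largestPart r + trues (boundary r)                  ≡⟨ cong (x ∸ largestPart r +_) (trues-boundary (Linked.tail l)) ⟩
  x ∸ largestPart r + largestPart r                       ≡⟨ m∸n+n≡m (largestPart-≤ l) ⟩
  x                                                       ∎
  where open ≡-Reasoning

parts-boundary : ∀ {λs} → Linked _≥_ λs → parts (boundary λs) ≡ λs
parts-boundary {[]}    _ = refl
parts-boundary {x ∷ r} l = cong₂ _∷_ (trues-boundary l)
  (trans (parts-replicate-++ (x ∸ largestPart r) (boundary r)) (parts-boundary (Linked.tail l)))

trues≡leadingTrues+largestPart : ∀ w → trues w ≡ leadingTrues w + largestPart (parts w)
trues≡leadingTrues+largestPart []          = refl
trues≡leadingTrues+largestPart (true ∷ w)  = cong suc (trues≡leadingTrues+largestPart w)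
trues≡leadingTrues+largestPart (false ∷ w) = refl

replicate-leadingTrues-++ : ∀ w → replicate (leadingTrues w) true ++ dropLeadingTrues w ≡ w
replicate-leadingTrues-++ []          = refl
replicate-leadingTrues-++ (true ∷ w)  = cong (true ∷_) (replicate-leadingTrues-++ w)
replicate-leadingTrues-++ (false ∷ w) = refl

boundary-parts : ∀ w → boundary (parts w) ≡ dropLeadingTrues w
boundary-parts []          = refl
boundary-parts (true ∷ w)  = boundary-parts w
boundary-parts (false ∷ w) = cong (false ∷_) (begin
  replicate (trues w ∸ largestPart (parts w)) true ++ boundary (parts w)
    ≡⟨ cong₂ (λ k v → replicate k true ++ v) gap (boundary-parts w) ⟩
  replicate (leadingTrues w) true ++ dropLeadingTrues w
    ≡⟨ replicate-leadingTrues-++ w ⟩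
  w ∎)
  where
  open ≡-Reasoning
  gap : trues w ∸ largestPart (parts w) ≡ leadingTrues w
  gap = trans (cong (_∸ largestPart (parts w)) (trues≡leadingTrues+largestPart w))
              (m+n∸n≡m (leadingTrues w) (largestPart (parts w)))

linked-∷ : ∀ {x xs} → largestPart xs ≤ x → Linked _≥_ xs → Linked _≥_ (x ∷ xs)
linked-∷ {xs = []}    _   _ = [-]
linked-∷ {xs = _ ∷ _} x≥y l = x≥y ∷ l

parts-decreasing : ∀ w → Linked _≥_ (parts w)
parts-decreasing []          = []
parts-decreasing (true ∷ w)  = parts-decreasing w
parts-decreasing (false ∷ w) = linked-∷
  (subst (largestPart (parts w) ≤_) (sym (trues≡leadingTrues+largestPart w)) (m≤n+m _ (leadingTrues w)))
  (parts-decreasing w)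

parts-positive : ∀ w → All (0 <_) (parts (w ∷ʳ true))
parts-positive []          = []
parts-positive (true ∷ w)  = parts-positive w
parts-positive (false ∷ w) = subst (0 <_) (sym (trues-∷ʳ w true)) (m≤n+m 1 (trues w)) ∷ parts-positive w

boundary-endsWith-last : ∀ x r → ∃₂ λ u y → last (x ∷ r) ≡ just y × boundary (x ∷ r) ≡ u ++ false ∷ replicate y true
boundary-endsWith-last x []      = [] , x , refl , cong (false ∷_) (++-identityʳ (replicate x true))
boundary-endsWith-last x (y ∷ r) with boundary-endsWith-last y r
... | u , z , last≡z , boundary≡ = prefix ++ u , z , last≡z , (begin
  prefix ++ boundary (y ∷ r)                       ≡⟨ cong (prefix ++_) boundary≡ ⟩
  prefix ++ u ++ false ∷ replicate z true          ≡⟨ ++-assoc prefix u _ ⟨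
  (prefix ++ u) ++ false ∷ replicate z true        ∎)
  where
  open ≡-Reasoning
  prefix : Word
  prefix = false ∷ replicate (x ∸ y) true

dual-boundary-startsWith-false : ∀ {x r} → All (0 <_) (x ∷ r) → ∃[ v ] dual (boundary (x ∷ r)) ≡ false ∷ v
dual-boundary-startsWith-false {x} {r} positive with boundary-endsWith-last x r
... | u , y , last≡y , boundary≡ with subst (Maybe.All (0 <_)) last≡y (last⁺ positive)
... | just (s≤s {n = k} _) = (replicate k false ∷ʳ true) ++ dual u ,
  trans (cong dual boundary≡) (dual-++-false∷replicate u (suc k))

conjugate-positive : ∀ λs → All (0 <_) (conjugate λs)
conjugate-positive []      = []
conjugate-positive (x ∷ r) = subst (All (0 <_) ∘ parts) (sym (dual-∷ false rest)) (parts-positive (dual rest))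
  where
  rest : Word
  rest = replicate (x ∸ largestPart r) true ++ boundary r

conjugate-partition : ∀ {m λs} → IsPartition m λs → IsPartition m (conjugate λs)
conjugate-partition {m} {λs} p = record
  { positive   = conjugate-positive λs
  ; decreasing = parts-decreasing (dual (boundary λs))
  ; sums       = begin
      sum (parts (dual (boundary λs))) ≡⟨ sum-parts-dual (boundary λs) ⟩
      sum (parts (boundary λs))        ≡⟨ cong sum (parts-boundary (decreasing p)) ⟩
      sum λs                           ≡⟨ sums p ⟩
      m                                ∎
  }
  where open ≡-Reasoning

boundary-conjugate : ∀ {m λs} → IsPartition m λs → boundary (conjugate λs) ≡ dual (boundary λs)
boundary-conjugate {λs = []}    _ = refl
boundary-conjugate {λs = x ∷ r} p with dual-boundary-startsWith-false {x} {r} (positive p)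
... | v , dual≡ = begin
  boundary (parts (dual (boundary (x ∷ r)))) ≡⟨ boundary-parts (dual (boundary (x ∷ r))) ⟩
  dropLeadingTrues (dual (boundary (x ∷ r))) ≡⟨ cong dropLeadingTrues dual≡ ⟩
  false ∷ v                                  ≡⟨ dual≡ ⟨
  dual (boundary (x ∷ r))                    ∎
  where open ≡-Reasoning

conjugate-involutive : ∀ {m λs} → IsPartition m λs → conjugate (conjugate λs) ≡ λs
conjugate-involutive {λs = λs} p = begin
  parts (dual (boundary (conjugate λs))) ≡⟨ cong (parts ∘ dual) (boundary-conjugate p) ⟩
  parts (dual (dual (boundary λs)))      ≡⟨ cong parts (dual-involutive (boundary λs)) ⟩
  parts (boundary λs)                    ≡⟨ parts-boundary (decreasing p) ⟩
  λs                                     ∎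
  where open ≡-Reasoning

count-∷-self : ∀ x r → count x (x ∷ r) ≡ suc (count x r)
count-∷-self x r = cong length (filter-accept (_≟ x) refl)

count-all-< : ∀ {x r} → All (_< x) r → count x r ≡ 0
count-all-< {x} r<x = cong length (filter-none (_≟ x) (All.map <⇒≢ r<x))

count-largest : ∀ {x r} → All (0 <_) (x ∷ r) → Linked _≥_ (x ∷ r) →
                count x (x ∷ r) ≡ leadingFalses (boundary (x ∷ r))
count-largest {suc x} {[]} _ _ = count-∷-self (suc x) []
count-largest {x} {y ∷ r} (_ ∷ positive) (y≤x ∷ l) with m≤n⇒m<n∨m≡n y≤x
... | inj₂ refl rewrite n∸n≡0 x = trans (count-∷-self x (x ∷ r)) (cong suc (count-largest positive l))
... | inj₁ y<x with x ∸ y | m<n⇒0<n∸m y<x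
...   | suc _ | _ = trans (count-∷-self x (y ∷ r)) (cong suc (count-all-< rest<x))
  where
  rest≤y : All (_≤ y) (y ∷ r)
  rest≤y = Linked⇒All (λ b≤a c≤b → ≤-trans c≤b b≤a) ≤-refl l
  rest<x : All (_< x) (y ∷ r)
  rest<x = All.map (λ z≤y → ≤-<-trans z≤y y<x) rest≤y

Odd-cong : ∀ {a b} → a ≡ b → Odd a ⇔ Odd b
Odd-cong a≡b = mk⇔ (subst Odd a≡b) (subst Odd (sym a≡b))

LargestOddMult⇔ : ∀ {m λs} → IsPartition m λs → LargestOddMult λs ⇔ Odd (leadingFalses (boundary λs))
LargestOddMult⇔ {λs = []}    _ = mk⇔ (λ ()) (λ ())
LargestOddMult⇔ {λs = _ ∷ _} p = Odd-cong (count-largest (positive p) (decreasing p))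

SmallestOdd-last : ∀ {xs y} → last xs ≡ just y → SmallestOdd xs ⇔ Odd y
SmallestOdd-last last≡y rewrite last≡y = ⇔-id _

SmallestOdd⇔ : ∀ λs → SmallestOdd λs ⇔ Odd (leadingFalses (dual (boundary λs)))
SmallestOdd⇔ []      = mk⇔ (λ ()) (λ ())
SmallestOdd⇔ (x ∷ r) with boundary-endsWith-last x r
... | u , y , last≡y , boundary≡ = begin
  SmallestOdd (x ∷ r)                                       ∼⟨ SmallestOdd-last {x ∷ r} last≡y ⟩
  Odd y                                                     ∼⟨ Odd-cong smallest ⟩
  Odd (leadingFalses (dual (boundary (x ∷ r))))             ∎
  where
  open EquationalReasoning
  smallest : y ≡ leadingFalses (dual (boundary (x ∷ r)))
  smallest = sym (trans (cong (leadingFalses ∘ dual) boundary≡)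
                        (trans (cong leadingFalses (dual-++-false∷replicate u y)) (leadingFalses-replicate y (dual u))))

LargestOddMult-conjugate⇔ : ∀ {m λs} → IsPartition m λs → LargestOddMult (conjugate λs) ⇔ SmallestOdd λs
LargestOddMult-conjugate⇔ {λs = λs} p = begin
  LargestOddMult (conjugate λs)                    ∼⟨ LargestOddMult⇔ (conjugate-partition p) ⟩
  Odd (leadingFalses (boundary (conjugate λs)))    ∼⟨ Odd-cong (cong leadingFalses (boundary-conjugate p)) ⟩
  Odd (leadingFalses (dual (boundary λs)))         ∼⟨ ⇔-sym (SmallestOdd⇔ λs) ⟩
  SmallestOdd λs                                   ∎
  where open EquationalReasoning

IsPartition-irrelevant : ∀ {m} λs → Irrelevant (IsPartition m λs)
IsPartition-irrelevant _ record { positive = a ; decreasing = b ; sums = c }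
                         record { positive = a′ ; decreasing = b′ ; sums = c′ }
  with All.irrelevant <-irrelevant a a′ | Linked.irrelevant ≤-irrelevant b b′ | ≡-irrelevant c c′
... | refl | refl | refl = refl

LargestOddMult-irrelevant : ∀ λs → Irrelevant (LargestOddMult λs)
LargestOddMult-irrelevant (_ ∷ _) = ≡-irrelevant

SmallestOdd-irrelevant : ∀ λs → Irrelevant (SmallestOdd λs)
SmallestOdd-irrelevant λs with last λs
... | just _  = ≡-irrelevant
... | nothing = λ ()

involution-↔ : {A : Set} {R P Q : A → Set} (f : A → A) →
               (∀ x → Irrelevant (R x)) → (∀ x → Irrelevant (P x)) → (∀ x → Irrelevant (Q x)) →
               (∀ {x} → R x → R (f x)) → (∀ {x} → R x → f (f x) ≡ x) → (∀ {x} → R x → P (f x) ⇔ Q x) →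
               Σ A (λ x → R x × P x) ↔ Σ A (λ x → R x × Q x)
involution-↔ {A} {R} {P} {Q} f R-irr P-irr Q-irr f-R f-f P∘f⇔Q = mk↔ₛ′ to from to∘from from∘to
  where
  to : Σ A (λ x → R x × P x) → Σ A (λ x → R x × Q x)
  to (x , r , p) = f x , f-R r , Equivalence.to (P∘f⇔Q (f-R r)) (subst P (sym (f-f r)) p)

  from : Σ A (λ x → R x × Q x) → Σ A (λ x → R x × P x)
  from (y , r , q) = f y , f-R r , Equivalence.from (P∘f⇔Q r) q

  Σ-≡ : {S : A → Set} → (∀ x → Irrelevant (S x)) → ∀ {x y} → x ≡ y →
        (a : R x × S x) (b : R y × S y) → _≡_ {A = Σ A (λ x → R x × S x)} (x , a) (y , b)
  Σ-≡ S-irr {x} refl (r , s) (r′ , s′) = cong₂ (λ r s → x , r , s) (R-irr x r r′) (S-irr x s s′)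

  to∘from : ∀ y → to (from y) ≡ y
  to∘from (y , r , q) = Σ-≡ Q-irr (f-f r) _ _

  from∘to : ∀ x → from (to x) ≡ x
  from∘to (x , r , p) = Σ-≡ P-irr (f-f r) _ _

corollary3p5 : (n : ℕ) → Lo (suc n) ↔ S (suc n)
corollary3p5 n = involution-↔ conjugate IsPartition-irrelevant LargestOddMult-irrelevant SmallestOdd-irrelevant
                              conjugate-partition conjugate-involutive LargestOddMult-conjugate⇔
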